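{- For the under-down pattern $UD$ and all integers $N\ge1$, $j\ge0$: if $2j+1\le N$ then \[T^{UD}_{N,2j+1}=N-\frac{N-j}{2^{\nu_2(N-j)+1}}+\frac12,\] and if $1\le 2j\le N$ then $T^{UD}_{N,2j}=j$.
   Context: $UD$ denotes the periodic dealing pattern $UDUDUD\cdots$. Dealing a deck of $N$ cards (positions $1,\dots,N$ from the top) by a pattern means: process the letters in order; for a $U$ move the top card to the bottom; for a $D$ remove the top card (deal it); stop when all $N$ cards are dealt. For $1\le k\le N$, $T^{UD}_{N,k}$ is the number $j$ such that the card initially at position $k$ is the $j$th card dealt. $\nu_2(n)$ is the exponent of the highest power of $2$ dividing $n$. -}

module Defs where

open import Data.Nat using (ℕ; zero; suc; _+_; _*_; _∸_; _^_; _%_; _/_; _≟_)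
open import Data.Nat.Properties using (m^n≢0)
open import Data.List using (List; []; _∷_; _++_; [_]; upTo; map)
open import Relation.Nullary using (yes; no)

data Letter : Set where
  U D : Letter

UD : ℕ → Letter
UD i with i % 2
... | zero = U
... | suc _ = D

-- Process the letters pat i, pat (i+1), ... (at most `fuel` of them) on a deck
-- (list of card labels, top first); stop as soon as the deck is empty.
dealWith : ℕ → (ℕ → Letter) → ℕ → List ℕ → List ℕ
dealWith _ pat i [] = []
dealWith zero pat i (x ∷ xs) = []
dealWith (suc fuel) pat i (x ∷ xs) with pat i
... | U = dealWith fuel pat (suc i) (xs ++ [ x ])
... | D = x ∷ dealWith fuel pat (suc i) xs

-- deck of N cards labelled by their initial positions 1..N from the top
deck : ℕ → List ℕ
deck N = map suc (upTo N)

-- the order in which the cards are dealt with the pattern UD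
-- (2N letters of UDUD... always suffice to deal all N cards)
dealtUD : ℕ → List ℕ
dealtUD N = dealWith (2 * N) UD 0 (deck N)

-- 1-based index of k in a list (junk value if absent)
indexOf : ℕ → List ℕ → ℕ
indexOf k [] = zero
indexOf k (x ∷ xs) with x ≟ k
... | yes _ = 1
... | no _ = suc (indexOf k xs)

-- T^{UD}_{N,k}: the card initially at position k is the T-th card dealt
T-UD : ℕ → ℕ → ℕ
T-UD N k = indexOf k (dealtUD N)

-- 2-adic valuation (ν₂ 0 = 0 by convention; never used at 0 here)
ν₂-aux : ℕ → ℕ → ℕ
ν₂-aux zero n = zero
ν₂-aux (suc fuel) zero = zero
ν₂-aux (suc fuel) (suc n) with suc n % 2
... | zero = suc (ν₂-aux fuel (suc n / 2))
... | suc _ = zero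

ν₂ : ℕ → ℕ
ν₂ n = ν₂-aux n n

div2^ν₂ : ℕ → ℕ
div2^ν₂ n = _/_ n (2 ^ ν₂ n) {{m^n≢0 2 (ν₂ n)}}

{-# OPTIONS --safe #-}
-- A round U D deals the second card and puts the top card at the bottom of a deck
-- with one card fewer, which gives the recursion dealRank for the rank of the card at
-- position p.  Unwinding it j times, the card at position 2j is dealt in round j, and
-- the card at position 2j + 1 is dealt j places after the top card of an (N - j)-card
-- deck would be.  After one round the top card of an M-card deck is the last of M - 1
-- cards, hence for odd M it is dealt in round (M + 1)/2, and for even M it becomes
-- M/2 - 1 rounds later the top card of an M/2-card deck.  As M and M/2 have the same
-- odd part, strong induction on M gives 2 T(M, 1) + M / 2^ν₂(M) = 2M + 1.
module Submission where

open import Defs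
open import Data.Nat using (ℕ; zero; suc; _+_; _*_; _∸_; _^_; _≤_; _<_; _/_; _%_; _≟_; s≤s; z≤n; z<s)
open import Data.Nat.Properties
open import Data.Nat.DivMod using (m*n%n≡0; [m+kn]%n≡m%n; m*n/n≡m; n/1≡n; m/n<m; m*n/m*o≡n/o)
open import Data.Nat.Induction using (<-rec)
open import Data.Nat.Tactic.RingSolver using (solve)
open import Data.Product using (_×_; _,_)
open import Data.List using ([]; _∷_; _++_; [_]; length; applyUpTo)
open import Data.List.Properties using (length-++; ++-assoc; length-applyUpTo; map-upTo)
open import Data.List.Relation.Unary.All as All using (All)
open import Data.List.Relation.Unary.All.Properties using (∷ʳ⁺; applyUpTo⁺₁; applyUpTo⁺₂)
open import Function using (_∘_)
open import Relation.Nullary.Decidable using (dec-no)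
open import Relation.Binary.PropositionalEquality
  using (_≡_; _≢_; refl; sym; trans; cong; cong₂; module ≡-Reasoning)

open ≡-Reasoning

UD-even : ∀ m → UD (m * 2) ≡ U
UD-even m rewrite m*n%n≡0 m 2 ⦃ _ ⦄ = refl

UD-odd : ∀ m → UD (suc (m * 2)) ≡ D
UD-odd m rewrite [m+kn]%n≡m%n 1 m 2 ⦃ _ ⦄ = refl

dealWith-UD-pair : ∀ f m a b xs →
  dealWith (suc (suc f)) UD (m * 2) (a ∷ b ∷ xs) ≡ b ∷ dealWith f UD (suc m * 2) (xs ++ [ a ])
dealWith-UD-pair f m a b xs rewrite UD-even m | UD-odd m = refl

dealWith-UD-single : ∀ f m a → dealWith (suc (suc f)) UD (m * 2) [ a ] ≡ [ a ]
dealWith-UD-single f m a rewrite UD-even m | UD-odd m = refl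

indexOf-head : ∀ k xs → indexOf k (k ∷ xs) ≡ 1
indexOf-head k xs rewrite ≟-diag (refl {x = k}) = refl

indexOf-tail : ∀ {x k} xs → x ≢ k → indexOf k (x ∷ xs) ≡ suc (indexOf k xs)
indexOf-tail {x} {k} xs x≢k rewrite dec-no (x ≟ k) x≢k = refl

indexOf-dealWith-UD-pair : ∀ {f m a b k} xs → b ≢ k →
  indexOf k (dealWith (suc (suc f)) UD (m * 2) (a ∷ b ∷ xs))
    ≡ suc (indexOf k (dealWith f UD (suc m * 2) (xs ++ [ a ])))
indexOf-dealWith-UD-pair {f} {m} {a} {b} {k} xs b≢k =
  trans (cong (indexOf k) (dealWith-UD-pair f m a b xs)) (indexOf-tail _ b≢k)

-- The last clause is the one-card deck; its other instances (p = 0, or p > n) are junk.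
dealRank : ℕ → ℕ → ℕ
dealRank (suc (suc n)) 1 = suc (dealRank (suc n) (suc n))
dealRank (suc (suc n)) 2 = 1
dealRank (suc (suc n)) (suc (suc (suc p))) = suc (dealRank (suc n) (suc p))
dealRank _ _ = 1

indexOf-dealWith-UD : ∀ n m pre k post → length pre + length post ≡ n →
  All (_≢ k) pre → All (_≢ k) post →
  indexOf k (dealWith (suc n * 2) UD (m * 2) (pre ++ k ∷ post)) ≡ dealRank (suc n) (suc (length pre))
indexOf-dealWith-UD zero m [] k [] _ _ _ =
  trans (cong (indexOf k) (dealWith-UD-single 0 m k)) (indexOf-head k [])
indexOf-dealWith-UD (suc n) m [] k (b ∷ post) len _ (b≢k All.∷ post≢k) =
  trans (indexOf-dealWith-UD-pair {m = m} post b≢k) (cong suc (begin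
    indexOf k (dealWith (suc n * 2) UD (suc m * 2) (post ++ [ k ]))
      ≡⟨ indexOf-dealWith-UD n (suc m) post k [] (trans (+-identityʳ (length post)) len′) post≢k All.[] ⟩
    dealRank (suc n) (suc (length post))
      ≡⟨ cong (dealRank (suc n) ∘ suc) len′ ⟩
    dealRank (suc n) (suc n) ∎))
  where
  len′ : length post ≡ n
  len′ = suc-injective len
indexOf-dealWith-UD (suc n) m (a ∷ []) k post _ _ _ =
  trans (cong (indexOf k) (dealWith-UD-pair _ m a k post)) (indexOf-head k _)
indexOf-dealWith-UD (suc (suc n)) m (a ∷ b ∷ pre) k post len (a≢k All.∷ b≢k All.∷ pre≢k) post≢k =
  trans (indexOf-dealWith-UD-pair {m = m} (pre ++ k ∷ post) b≢k) (cong suc (begin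
    indexOf k (dealWith _ UD (suc m * 2) ((pre ++ k ∷ post) ++ [ a ]))
      ≡⟨ cong (indexOf k ∘ dealWith _ UD (suc m * 2)) (++-assoc pre (k ∷ post) [ a ]) ⟩
    indexOf k (dealWith _ UD (suc m * 2) (pre ++ k ∷ post ++ [ a ]))
      ≡⟨ indexOf-dealWith-UD (suc n) (suc m) pre k (post ++ [ a ]) lengths pre≢k (∷ʳ⁺ post≢k a≢k) ⟩
    dealRank (suc (suc n)) (suc (length pre)) ∎))
  where
  lengths : length pre + length (post ++ [ a ]) ≡ suc n
  lengths = begin
    length pre + length (post ++ [ a ])  ≡⟨ cong (length pre +_) (length-++ post) ⟩
    length pre + (length post + 1)       ≡⟨ cong (length pre +_) (+-comm (length post) 1) ⟩
    length pre + suc (length post)       ≡⟨ +-suc (length pre) (length post) ⟩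
    suc (length pre + length post)       ≡⟨ suc-injective len ⟩
    suc n                                ∎

applyUpTo-split : ∀ {A : Set} (f : ℕ → A) d e →
  applyUpTo f (suc (d + e)) ≡ applyUpTo f d ++ f d ∷ applyUpTo (f ∘ suc ∘ (d +_)) e
applyUpTo-split f zero e = refl
applyUpTo-split f (suc d) e = cong (f 0 ∷_) (applyUpTo-split (f ∘ suc) d e)

T-UD≡dealRank : ∀ {N k} → 1 ≤ k → k ≤ N → T-UD N k ≡ dealRank N k
T-UD≡dealRank {k = suc d} _ k≤N with m≤n⇒∃[o]m+o≡n k≤N
... | e , refl = begin
  T-UD (suc (d + e)) (suc d)
    ≡⟨ cong₂ (λ f xs → indexOf (suc d) (dealWith f UD 0 xs))
             (*-comm 2 (suc (d + e))) (trans (map-upTo suc _) (applyUpTo-split suc d e)) ⟩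
  indexOf (suc d) (dealWith (suc (d + e) * 2) UD (0 * 2) (below ++ suc d ∷ above))
    ≡⟨ indexOf-dealWith-UD (d + e) 0 below (suc d) above lengths
         (applyUpTo⁺₁ suc d (λ i<d → <⇒≢ (s≤s i<d)))
         (applyUpTo⁺₂ _ e (λ i → >⇒≢ (s≤s (s≤s (m≤m+n d i))))) ⟩
  dealRank (suc (d + e)) (suc (length below))
    ≡⟨ cong (dealRank (suc (d + e)) ∘ suc) (length-applyUpTo suc d) ⟩
  dealRank (suc (d + e)) (suc d) ∎
  where
  below = applyUpTo suc d
  above = applyUpTo (suc ∘ suc ∘ (d +_)) e
  lengths : length below + length above ≡ d + e
  lengths = cong₂ _+_ (length-applyUpTo suc d) (length-applyUpTo _ e)

dealRank-odd : ∀ j {N} → j < N → dealRank N (suc (j * 2)) ≡ j + dealRank (N ∸ j) 1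
dealRank-odd zero _ = refl
dealRank-odd (suc j) {suc (suc N)} (s≤s j<N) = cong suc (dealRank-odd j j<N)
dealRank-odd (suc j) {suc zero} (s≤s ())

dealRank-even : ∀ j {N} → suc j < N → dealRank N (suc (suc (j * 2))) ≡ suc j
dealRank-even zero {suc (suc N)} _ = refl
dealRank-even (suc j) {suc (suc N)} (s≤s sj<N) = cong suc (dealRank-even j sj<N)
dealRank-even _ {suc zero} (s≤s ())

infixl 7 _/2^_
_/2^_ : ℕ → ℕ → ℕ
m /2^ k = _/_ m (2 ^ k) {{m^n≢0 2 k}}

ν₂-aux-fuel : ∀ {f g} n → n ≤ f → n ≤ g → ν₂-aux f n ≡ ν₂-aux g n
ν₂-aux-fuel {zero}  {zero}  zero _ _ = refl
ν₂-aux-fuel {zero}  {suc _} zero _ _ = refl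
ν₂-aux-fuel {suc _} {zero}  zero _ _ = refl
ν₂-aux-fuel {suc _} {suc _} zero _ _ = refl
ν₂-aux-fuel {suc f} {suc g} (suc n) (s≤s n≤f) (s≤s n≤g) with suc n % 2
... | zero  = cong suc (ν₂-aux-fuel (suc n / 2) (≤-trans half≤n n≤f) (≤-trans half≤n n≤g))
  where
  half≤n : suc n / 2 ≤ n
  half≤n = ≤-pred (m/n<m (suc n) 2 (s≤s (s≤s z≤n)))
... | suc _ = refl

ν₂-double : ∀ n → ν₂ (suc n * 2) ≡ suc (ν₂ (suc n))
ν₂-double n rewrite m*n%n≡0 (suc n) 2 ⦃ _ ⦄ | m*n/n≡m (suc n) 2 ⦃ _ ⦄ =
  cong suc (ν₂-aux-fuel (suc n) (s≤s (m≤m*n n 2)) ≤-refl)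

div2^ν₂-odd : ∀ i → div2^ν₂ (suc (i * 2)) ≡ suc (i * 2)
div2^ν₂-odd i rewrite [m+kn]%n≡m%n 1 i 2 ⦃ _ ⦄ = n/1≡n (suc (i * 2))

div2^ν₂-double : ∀ n → div2^ν₂ (suc n * 2) ≡ div2^ν₂ (suc n)
div2^ν₂-double n = begin
  suc n * 2 /2^ ν₂ (suc n * 2)  ≡⟨ cong (suc n * 2 /2^_) (ν₂-double n) ⟩
  suc n * 2 /2^ suc v           ≡⟨ cong (_/2^ suc v) (*-comm (suc n) 2) ⟩
  2 * suc n /2^ suc v           ≡⟨ m*n/m*o≡n/o 2 (suc n) (2 ^ v) {{m^n≢0 2 v}} {{m^n≢0 2 (suc v)}} ⟩
  suc n /2^ v                   ∎
  where v = ν₂ (suc n)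

data Parity : ℕ → Set where
  even : ∀ i → Parity (i * 2)
  odd  : ∀ i → Parity (suc (i * 2))

parity : ∀ n → Parity n
parity zero = even 0
parity (suc n) with parity n
... | even i = odd i
... | odd i  = even (suc i)

2*[a+b]+c≡2*a+[2*b+c] : ∀ a b c → 2 * (a + b) + c ≡ 2 * a + (2 * b + c)
2*[a+b]+c≡2*a+[2*b+c] a b c = solve (a ∷ b ∷ c ∷ [])

dealRank-top : ∀ {M} → 0 < M → 2 * dealRank M 1 + div2^ν₂ M ≡ 2 * M + 1
dealRank-top {M} = <-rec (λ M → 0 < M → 2 * dealRank M 1 + div2^ν₂ M ≡ 2 * M + 1) step M
  where
  step : ∀ M → (∀ {M′} → M′ < M → 0 < M′ → 2 * dealRank M′ 1 + div2^ν₂ M′ ≡ 2 * M′ + 1) →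
         0 < M → 2 * dealRank M 1 + div2^ν₂ M ≡ 2 * M + 1
  step (suc zero) _ _ = refl
  step (suc (suc m)) rec _ with parity m
  ... | even i = begin
    2 * suc (dealRank (suc (i * 2)) (suc (i * 2))) + div2^ν₂ (suc i * 2)
      ≡⟨ cong₂ (λ r d → 2 * suc r + d) (dealRank-odd i (s≤s (m≤m*n i 2))) (div2^ν₂-double i) ⟩
    2 * suc (i + dealRank (suc (i * 2) ∸ i) 1) + div2^ν₂ (suc i)
      ≡⟨ cong (λ M → 2 * suc (i + dealRank M 1) + div2^ν₂ (suc i)) halve ⟩
    2 * (suc i + dealRank (suc i) 1) + div2^ν₂ (suc i)
      ≡⟨ 2*[a+b]+c≡2*a+[2*b+c] (suc i) _ _ ⟩
    2 * suc i + (2 * dealRank (suc i) 1 + div2^ν₂ (suc i))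
      ≡⟨ cong (2 * suc i +_) (rec (s≤s (s≤s (m≤m*n i 2))) z<s) ⟩
    2 * suc i + (2 * suc i + 1)
      ≡⟨ solve (i ∷ []) ⟩
    2 * (suc i * 2) + 1 ∎
    where
    halve : suc (i * 2) ∸ i ≡ suc i
    halve = begin
      suc (i * 2) ∸ i  ≡⟨ cong (_∸ i) (solve (i ∷ [])) ⟩
      suc i + i ∸ i    ≡⟨ m+n∸n≡m (suc i) i ⟩
      suc i            ∎
  ... | odd i = begin
    2 * suc (dealRank (suc i * 2) (suc i * 2)) + div2^ν₂ (suc (suc i * 2))
      ≡⟨ cong₂ (λ r d → 2 * suc r + d) (dealRank-even i (s≤s (s≤s (m≤m*n i 2)))) (div2^ν₂-odd (suc i)) ⟩
    2 * suc (suc i) + suc (suc i * 2)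
      ≡⟨ solve (i ∷ []) ⟩
    2 * suc (suc i * 2) + 1 ∎

T-UD-odd : ∀ {N} j → 2 * j + 1 ≤ N → 2 * T-UD N (2 * j + 1) + div2^ν₂ (N ∸ j) ≡ 2 * N + 1
T-UD-odd {N} j h = begin
  2 * T-UD N (2 * j + 1) + div2^ν₂ (N ∸ j)
    ≡⟨ cong (λ t → 2 * t + div2^ν₂ (N ∸ j)) T-UD≡ ⟩
  2 * (j + dealRank (N ∸ j) 1) + div2^ν₂ (N ∸ j)
    ≡⟨ 2*[a+b]+c≡2*a+[2*b+c] j _ _ ⟩
  2 * j + (2 * dealRank (N ∸ j) 1 + div2^ν₂ (N ∸ j))
    ≡⟨ cong (2 * j +_) (dealRank-top (m<n⇒0<n∸m j<N)) ⟩
  2 * j + (2 * (N ∸ j) + 1)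
    ≡⟨ sym (2*[a+b]+c≡2*a+[2*b+c] j (N ∸ j) 1) ⟩
  2 * (j + (N ∸ j)) + 1
    ≡⟨ cong (λ n → 2 * n + 1) (m+[n∸m]≡n (<⇒≤ j<N)) ⟩
  2 * N + 1 ∎
  where
  position : 2 * j + 1 ≡ suc (j * 2)
  position = solve (j ∷ [])
  j<N : j < N
  j<N = ≤-trans (s≤s (m≤m*n j 2)) (≤-trans (≤-reflexive (sym position)) h)
  T-UD≡ : T-UD N (2 * j + 1) ≡ j + dealRank (N ∸ j) 1
  T-UD≡ = trans (T-UD≡dealRank (m≤n+m 1 (2 * j)) h)
                (trans (cong (dealRank N) position) (dealRank-odd j j<N))

T-UD-even : ∀ {N} j → 1 ≤ 2 * j → 2 * j ≤ N → T-UD N (2 * j) ≡ j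
T-UD-even {N} (suc j) h₁ h₂ =
  trans (T-UD≡dealRank h₁ h₂) (trans (cong (dealRank N) (*-comm 2 (suc j))) (dealRank-even j j+1<N))
  where
  j+1<N : suc j < N
  j+1<N = ≤-trans (s≤s (s≤s (m≤m*n j 2))) (≤-trans (≤-reflexive (*-comm (suc j) 2)) h₂)

mainTheorem17 : (N j : ℕ) → 1 ≤ N →
    ((2 * j + 1 ≤ N →
        2 * T-UD N (2 * j + 1) + div2^ν₂ (N ∸ j) ≡ 2 * N + 1)
    × (1 ≤ 2 * j → 2 * j ≤ N → T-UD N (2 * j) ≡ j))
mainTheorem17 N j _ = T-UD-odd j , T-UD-even j
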